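{- Let $\mathcal P$ be a set of pre-tangles in a graph $G$, let $N$ be a nested set of separations of $G$ which efficiently distinguishes $\mathcal P$, and let $((A_i,B_i))_{i\in\mathbb N}$ be a strictly increasing sequence in $\vec N$. If $((A_i,B_i))_{i}$ is strongly $\mathcal P$-relevant, then there exists a sequence $(P_i)_{i\in\mathbb N}$ in $\mathcal P$ such that for all $i\in\mathbb N$: $(B_i,A_i)\in P_i$ and $(A_i,B_i)\in P_{i+1}$, and $\{A_i,B_i\}$ efficiently distinguishes $P_i$ and $P_{i+1}$.
   Context: A separation of a graph $G$ is an unordered pair $\{A,B\}$ of subsets of $V(G)$ with $A\cup B=V(G)$ and no edge between $A\setminus B$ and $B\setminus A$; its order is $|A\cap B|$. Its orientations are $(A,B),(B,A)$; $\vec N$ is the set of all orientations of elements of $N$. Oriented separations are ordered by $(A,B)\le(C,D)$ iff $A\subseteq C$ and $B\supseteq D$. Separations are nested if they have comparable orientations; a set is nested if pairwise nested. A set $O$ of oriented separations is consistent if there are no $(A,B),(C,D)\in O$ with $\{A,B\}\ne\{C,D\}$ and $(B,A)\le(C,D)$. A pre-tangle in $G$ is a set $P$ which, for some $k\in\mathbb N\cup\{\aleph_0\}$, is a consistent set containing exactly one orientation of each separation of $G$ of order less than $k$. A separation distinguishes two pre-tangles if both contain one of its orientations but not the same one, and does so efficiently if it has minimum order among all separations of $G$ distinguishing them. $N$ efficiently distinguishes $\mathcal P$ if any two pre-tangles in $\mathcal P$ distinguished by some separation of $G$ are efficiently distinguished by some element of $N$. A pair $(A,B)<(C,D)$ of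 oriented separations is strongly $\mathcal P$-relevant if there are $O,P,Q\in\mathcal P$ such that $\{A,B\}$ efficiently distinguishes $O$ and $P$ with $(A,B)\in P$, and $\{C,D\}$ efficiently distinguishes $P$ and $Q$ with $(D,C)\in P$. A strictly increasing sequence is strongly $\mathcal P$-relevant if every two consecutive members form a strongly $\mathcal P$-relevant pair. -}

module Defs where

open import Data.Bool using (Bool; T)
open import Data.Nat using (ℕ; suc; _≤_; _<_)
open import Data.Fin using (Fin)
open import Data.Product using (Σ; _×_; ∃)
open import Data.Sum using (_⊎_)
open import Data.Unit using (⊤)
open import Data.Empty using (⊥)
open import Relation.Nullary using (¬_)
open import Relation.Binary.PropositionalEquality using (_≡_)
open import Function.Bundles using (_↔_)
open import Level using (Level; 0ℓ) renaming (suc to lsuc)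

record Graph : Set₁ where
  field
    V   : Set
    E   : V → V → Set
    sym : ∀ {u v} → E u v → E v u

module _ (G : Graph) where
  open Graph G

  Subset : Set
  Subset = V → Bool

  -- an oriented separation (A , B) of G: A ∪ B = V and no edge between A∖B and B∖A
  record OSep : Set where
    constructor osep
    field
      A     : Subset
      B     : Subset
      cover : ∀ v → T (A v) ⊎ T (B v)
      noEdge : ∀ u v → E u v → T (A u) → ¬ T (B u) → T (B v) → ¬ T (A v) → ⊥
  open OSep public

  swap : OSep → OSep
  swap (osep A B c n) = osep B A (λ v → Data.Sum.swap (c v))
    (λ u v e bu ¬au av ¬bv → n v u (sym e) av ¬bv bu ¬au)
    where import Data.Sum

  _≐_ : OSep → OSep → Set
  s ≐ t = (∀ v → A s v ≡ A t v) × (∀ v → B s v ≡ B t v)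

  SameSep : OSep → OSep → Set
  SameSep s t = s ≐ t ⊎ s ≐ swap t

  _≤ₛ_ : OSep → OSep → Set
  s ≤ₛ t = (∀ v → T (A s v) → T (A t v)) × (∀ v → T (B t v) → T (B s v))

  _<ₛ_ : OSep → OSep → Set
  s <ₛ t = s ≤ₛ t × ¬ (s ≐ t)

  HasOrder : OSep → ℕ → Set
  HasOrder s n = Σ V (λ v → T (A s v) × T (B s v)) ↔ Fin n

  data Bound : Set where
    fin : ℕ → Bound
    ℵ₀  : Bound

  _<ᵇ_ : ℕ → Bound → Set
  n <ᵇ fin k = n < k
  n <ᵇ ℵ₀    = ⊤

  OrderLt : OSep → Bound → Set
  OrderLt s k = Σ ℕ (λ n → HasOrder s n × n <ᵇ k)

  -- sets of oriented separations are predicates; a genuine set of separations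
  -- must not distinguish equal separations
  SepSet : Set₁
  SepSet = OSep → Set

  Extensional : SepSet → Set
  Extensional P = ∀ s t → s ≐ t → P s → P t

  Consistent : SepSet → Set
  Consistent O = ∀ s t → O s → O t → ¬ SameSep s t → ¬ (swap s ≤ₛ t)

  -- pre-tangle: for some k, a consistent set consisting of exactly one
  -- orientation of each separation of order < k
  IsPreTangle : SepSet → Set
  IsPreTangle P =
    Extensional P ×
    Σ Bound (λ k →
      (∀ s → P s → OrderLt s k) ×
      (∀ s → OrderLt s k → (P s ⊎ P (swap s)) × (P s → P (swap s) → s ≐ swap s)) ×
      Consistent P)

  Distinguishes : OSep → SepSet → SepSet → Set
  Distinguishes s P Q =
    ((P s × Q (swap s)) ⊎ (P (swap s) × Q s)) × ¬ (s ≐ swap s)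

  EffDist : OSep → SepSet → SepSet → Set
  EffDist s P Q =
    Distinguishes s P Q ×
    Σ ℕ (λ n → HasOrder s n ×
      (∀ t → Distinguishes t P Q → ∀ m → HasOrder t m → n ≤ m))

  PreTangleSet : Set₂
  PreTangleSet = SepSet → Set₁

  AllPreTangles : PreTangleSet → Set₁
  AllPreTangles 𝒫 = ∀ P → 𝒫 P → IsPreTangle P

  -- N is a set of separations, given by (some of) their orientations;
  -- s ∈ N⃗ iff s is an orientation of some element of N
  InN : SepSet → OSep → Set
  InN N s = Σ OSep (λ t → N t × SameSep s t)

  Comparable : OSep → OSep → Set
  Comparable s t = s ≤ₛ t ⊎ t ≤ₛ s

  NestedPair : OSep → OSep → Set
  NestedPair s t = Comparable s t ⊎ Comparable s (swap t)
                 ⊎ Comparable (swap s) t ⊎ Comparable (swap s) (swap t)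

  Nested : SepSet → Set
  Nested N = ∀ s t → N s → N t → NestedPair s t

  EffDistinguishesSet : SepSet → PreTangleSet → Set₁
  EffDistinguishesSet N 𝒫 = ∀ P Q → 𝒫 P → 𝒫 Q →
    Σ OSep (λ s → Distinguishes s P Q) →
    Σ OSep (λ s → N s × EffDist s P Q)

  StronglyRelevantPair : PreTangleSet → OSep → OSep → Set₁
  StronglyRelevantPair 𝒫 s t =
    s <ₛ t ×
    Σ SepSet (λ O → Σ SepSet (λ P → Σ SepSet (λ Q →
      𝒫 O × 𝒫 P × 𝒫 Q ×
      EffDist s O P × P s ×
      EffDist t P Q × P (swap t))))

  StrictlyIncreasing : (ℕ → OSep) → Set
  StrictlyIncreasing f = ∀ i → f i <ₛ f (suc i)

  StronglyRelevantSeq : PreTangleSet → (ℕ → OSep) → Set₁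
  StronglyRelevantSeq 𝒫 f = ∀ i → StronglyRelevantPair 𝒫 (f i) (f (suc i))

-- Take P₀ = O₀ and P_{i+1} = M_i, where (O_i, M_i, Q_i) witness that the i-th pair
-- of the sequence is strongly relevant.  The separation x = f (i+1) efficiently
-- distinguishes M_i from Q_i and O_{i+1} from M_{i+1}; we show it also efficiently
-- distinguishes M_i from M_{i+1}.  A cheaper distinguisher of M_i and M_{i+1} may be
-- taken in N, hence nested with x.  Q_i and O_{i+1} contain x resp. its inverse, so
-- they orient this cheaper separation, and must orient it like M_i resp. M_{i+1}, or
-- it would undercut the efficiency of x.  Each of the four ways it can be nested
-- with x then contradicts the consistency of one of M_i, Q_i, O_{i+1}, M_{i+1}.
{-# OPTIONS --safe #-}
module Submission where

open import Defs
open import Data.Nat using (ℕ; suc; zero; _≤_; _<_)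
open import Data.Nat.Properties using (<-trans; <⇒≢; ≤⇒≯; ≤-<-trans; ≮⇒≥)
open import Data.Product using (Σ; _×_; _,_; proj₁; proj₂)
open import Data.Sum using (_⊎_; inj₁; inj₂)
open import Data.Empty using (⊥; ⊥-elim)
open import Data.Unit using (tt)
open import Data.Bool using (T)
open import Data.Bool.Properties using (T-irrelevant)
open import Relation.Nullary using (¬_)
open import Relation.Binary.PropositionalEquality
  using (_≡_; _≢_; refl; sym; subst; cong₂; ≢-sym)
open import Function.Bundles using (mk↔ₛ′)
open import Function.Properties.Inverse using (↔-sym; ↔-trans)
open import Data.Fin.Permutation using (↔⇒≡)

module _ (G : Graph) where
  open Graph G using (V)

  ≐-sym : ∀ s t → _≐_ G s t → _≐_ G t s
  ≐-sym _ _ (eA , eB) = (λ v → sym (eA v)) , (λ v → sym (eB v))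

  swap-resp-≐ : ∀ s t → _≐_ G s t → _≐_ G (swap G s) (swap G t)
  swap-resp-≐ _ _ (eA , eB) = eB , eA

  swap-involutive : ∀ s → _≐_ G s (swap G (swap G s))
  swap-involutive _ = (λ _ → refl) , (λ _ → refl)

  ≤ₛ-resp-≐ : ∀ s s′ t t′ → _≐_ G s s′ → _≐_ G t t′ → _≤ₛ_ G s t → _≤ₛ_ G s′ t′
  ≤ₛ-resp-≐ _ _ _ _ (sA , sB) (tA , tB) (A⊆ , B⊇) =
    (λ v a → subst T (tA v) (A⊆ v (subst T (sym (sA v)) a))) ,
    (λ v b → subst T (sB v) (B⊇ v (subst T (sym (tB v)) b)))

  ≤ₛ-swap : ∀ s t → _≤ₛ_ G s t → _≤ₛ_ G (swap G t) (swap G s)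
  ≤ₛ-swap _ _ (A⊆ , B⊇) = B⊇ , A⊆

  HasOrder-resp-≐ : ∀ s t {n} → _≐_ G s t → HasOrder G s n → HasOrder G t n
  HasOrder-resp-≐ s t (eA , eB) = ↔-trans (mk↔ₛ′ to from to∘from from∘to)
    where
    to : Σ V (λ v → T (A t v) × T (B t v)) → Σ V (λ v → T (A s v) × T (B s v))
    to (v , a , b) = v , subst T (sym (eA v)) a , subst T (sym (eB v)) b
    from : Σ V (λ v → T (A s v) × T (B s v)) → Σ V (λ v → T (A t v) × T (B t v))
    from (v , a , b) = v , subst T (eA v) a , subst T (eB v) b
    to∘from : ∀ w → to (from w) ≡ w
    to∘from (v , _ , _) = cong₂ (λ a b → v , a , b) (T-irrelevant _ _) (T-irrelevant _ _)
    from∘to : ∀ w → from (to w) ≡ w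
    from∘to (v , _ , _) = cong₂ (λ a b → v , a , b) (T-irrelevant _ _) (T-irrelevant _ _)

  HasOrder-swap : ∀ s {n} → HasOrder G s n → HasOrder G (swap G s) n
  HasOrder-swap _ = ↔-trans (mk↔ₛ′ flip flip (λ _ → refl) (λ _ → refl))
    where
    flip : ∀ {X Y : V → Set} → Σ V (λ v → X v × Y v) → Σ V (λ v → Y v × X v)
    flip (v , a , b) = v , b , a

  HasOrder-unique : ∀ s {m n} → HasOrder G s m → HasOrder G s n → m ≡ n
  HasOrder-unique _ hm hn = ↔⇒≡ (↔-trans (↔-sym hm) hn)

  SameSep⇒≡order : ∀ s t {m n} → SameSep G s t → HasOrder G s m → HasOrder G t n → m ≡ n
  SameSep⇒≡order s t (inj₁ e) hs = HasOrder-unique t (HasOrder-resp-≐ s t e hs)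
  SameSep⇒≡order s t (inj₂ e) hs =
    HasOrder-unique t (HasOrder-swap (swap G t) (HasOrder-resp-≐ s (swap G t) e hs))

  ≢order⇒¬SameSep : ∀ s t {m n} → HasOrder G s m → HasOrder G t n → m ≢ n → ¬ SameSep G s t
  ≢order⇒¬SameSep s t hs ht m≢n same = m≢n (SameSep⇒≡order s t same hs ht)

  Comparable-resp-≐ʳ : ∀ s t t′ → _≐_ G t t′ → Comparable G s t → Comparable G s t′
  Comparable-resp-≐ʳ s t t′ e (inj₁ s≤t) = inj₁ (≤ₛ-resp-≐ s s t t′ (swap-involutive s) e s≤t)
  Comparable-resp-≐ʳ s t t′ e (inj₂ t≤s) = inj₂ (≤ₛ-resp-≐ t t′ s s e (swap-involutive s) t≤s)

  NestedPair-resp-≐ʳ : ∀ r t t′ → _≐_ G t t′ → NestedPair G r t → NestedPair G r t′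
  NestedPair-resp-≐ʳ r t t′ e (inj₁ c) = inj₁ (Comparable-resp-≐ʳ r t t′ e c)
  NestedPair-resp-≐ʳ r t t′ e (inj₂ (inj₁ c)) =
    inj₂ (inj₁ (Comparable-resp-≐ʳ r (swap G t) (swap G t′) (swap-resp-≐ t t′ e) c))
  NestedPair-resp-≐ʳ r t t′ e (inj₂ (inj₂ (inj₁ c))) =
    inj₂ (inj₂ (inj₁ (Comparable-resp-≐ʳ (swap G r) t t′ e c)))
  NestedPair-resp-≐ʳ r t t′ e (inj₂ (inj₂ (inj₂ c))) =
    inj₂ (inj₂ (inj₂
      (Comparable-resp-≐ʳ (swap G r) (swap G t) (swap G t′) (swap-resp-≐ t t′ e) c)))

  NestedPair-swapˡ : ∀ r t → NestedPair G r t → NestedPair G (swap G r) t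
  NestedPair-swapˡ _ _ (inj₁ c) = inj₂ (inj₂ (inj₁ c))
  NestedPair-swapˡ _ _ (inj₂ (inj₁ c)) = inj₂ (inj₂ (inj₂ c))
  NestedPair-swapˡ _ _ (inj₂ (inj₂ (inj₁ c))) = inj₁ c
  NestedPair-swapˡ _ _ (inj₂ (inj₂ (inj₂ c))) = inj₂ (inj₁ c)

  NestedPair-swapʳ : ∀ r t → NestedPair G r t → NestedPair G r (swap G t)
  NestedPair-swapʳ _ _ (inj₁ c) = inj₂ (inj₁ c)
  NestedPair-swapʳ _ _ (inj₂ (inj₁ c)) = inj₁ c
  NestedPair-swapʳ _ _ (inj₂ (inj₂ (inj₁ c))) = inj₂ (inj₂ (inj₂ c))
  NestedPair-swapʳ _ _ (inj₂ (inj₂ (inj₂ c))) = inj₂ (inj₂ (inj₁ c))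

  NestedPair⇒≤ₛ : ∀ a x → NestedPair G a x →
    _≤ₛ_ G a x ⊎ _≤ₛ_ G x a ⊎ _≤ₛ_ G (swap G a) x ⊎ _≤ₛ_ G x (swap G a)
  NestedPair⇒≤ₛ a x (inj₁ (inj₁ a≤x)) = inj₁ a≤x
  NestedPair⇒≤ₛ a x (inj₁ (inj₂ x≤a)) = inj₂ (inj₁ x≤a)
  NestedPair⇒≤ₛ a x (inj₂ (inj₁ (inj₁ a≤x̄))) = inj₂ (inj₂ (inj₂ (≤ₛ-swap a (swap G x) a≤x̄)))
  NestedPair⇒≤ₛ a x (inj₂ (inj₁ (inj₂ x̄≤a))) = inj₂ (inj₂ (inj₁ (≤ₛ-swap (swap G x) a x̄≤a)))
  NestedPair⇒≤ₛ a x (inj₂ (inj₂ (inj₁ (inj₁ ā≤x)))) = inj₂ (inj₂ (inj₁ ā≤x))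
  NestedPair⇒≤ₛ a x (inj₂ (inj₂ (inj₁ (inj₂ x≤ā)))) = inj₂ (inj₂ (inj₂ x≤ā))
  NestedPair⇒≤ₛ a x (inj₂ (inj₂ (inj₂ (inj₁ ā≤x̄)))) =
    inj₂ (inj₁ (≤ₛ-swap (swap G a) (swap G x) ā≤x̄))
  NestedPair⇒≤ₛ a x (inj₂ (inj₂ (inj₂ (inj₂ x̄≤ā)))) =
    inj₁ (≤ₛ-swap (swap G x) (swap G a) x̄≤ā)

  Nested⇒NestedPair-InN : ∀ {N} → Nested G N → ∀ r x → N r → InN G N x → NestedPair G r x
  Nested⇒NestedPair-InN nested r x Nr (t , Nt , inj₁ x≐t) =
    NestedPair-resp-≐ʳ r t x (≐-sym x t x≐t) (nested r t Nr Nt)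
  Nested⇒NestedPair-InN nested r x Nr (t , Nt , inj₂ x≐t̄) =
    NestedPair-resp-≐ʳ r (swap G t) x (≐-sym x (swap G t) x≐t̄)
      (NestedPair-swapʳ r t (nested r t Nr Nt))

  <ᵇ-trans : ∀ {m n} k → m < n → _<ᵇ_ G n k → _<ᵇ_ G m k
  <ᵇ-trans (fin k) m<n n<k = <-trans m<n n<k
  <ᵇ-trans ℵ₀ _ _ = tt

  orients-below : ∀ {P} → IsPreTangle G P → ∀ x a {m n} → P x →
    HasOrder G x n → HasOrder G a m → m < n → P a ⊎ P (swap G a)
  orients-below (_ , k , bounded , orients , _) x a Px hx ha m<n with bounded x Px
  ... | _ , hx′ , n′<k = proj₁ (orients a (_ , ha , <ᵇ-trans k m<n
          (subst (λ n → _<ᵇ_ G n k) (HasOrder-unique x hx′ hx) n′<k)))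

  both⇒≐swap : ∀ {P} → IsPreTangle G P → ∀ x → P x → P (swap G x) → _≐_ G x (swap G x)
  both⇒≐swap (_ , _ , bounded , orients , _) x Px = proj₂ (orients x (bounded x Px)) Px

  consistent : ∀ {P} → IsPreTangle G P → Consistent G P
  consistent (_ , _ , _ , _ , cons) = cons

  swap-swap-∈ : ∀ {P} → IsPreTangle G P → ∀ s → P s → P (swap G (swap G s))
  swap-swap-∈ (extensional , _) s = extensional s _ (swap-involutive s)

  Distinguishes-sym : ∀ s P Q → Distinguishes G s P Q → Distinguishes G s Q P
  Distinguishes-sym _ _ _ (inj₁ (Ps , Qs̄) , nd) = inj₂ (Qs̄ , Ps) , nd
  Distinguishes-sym _ _ _ (inj₂ (Ps̄ , Qs) , nd) = inj₁ (Qs , Ps̄) , nd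

  Distinguishes⇒∈ʳ : ∀ {P} → IsPreTangle G P → ∀ s Q →
    P (swap G s) → Distinguishes G s P Q → Q s
  Distinguishes⇒∈ʳ ptP s _ Ps̄ (inj₁ (Ps , _) , nd) = ⊥-elim (nd (both⇒≐swap ptP s Ps Ps̄))
  Distinguishes⇒∈ʳ ptP s _ Ps̄ (inj₂ (_ , Qs) , _) = Qs

  Distinguishes⇒∈ˡ : ∀ {Q} → IsPreTangle G Q → ∀ s P →
    Q s → Distinguishes G s P Q → P (swap G s)
  Distinguishes⇒∈ˡ ptQ s _ Qs (inj₁ (_ , Qs̄) , nd) = ⊥-elim (nd (both⇒≐swap ptQ s Qs Qs̄))
  Distinguishes⇒∈ˡ ptQ s _ Qs (inj₂ (Ps̄ , _) , _) = Ps̄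

  OrderLowerBound : SepSet G → SepSet G → ℕ → Set
  OrderLowerBound P Q n = ∀ t → Distinguishes G t P Q → ∀ m → HasOrder G t m → n ≤ m

  OrderLowerBound-sym : ∀ P Q {n} → OrderLowerBound P Q n → OrderLowerBound Q P n
  OrderLowerBound-sym P Q bound t d = bound t (Distinguishes-sym t Q P d)

  EffDist⇒OrderLowerBound : ∀ s P Q {n} → EffDist G s P Q → HasOrder G s n →
    OrderLowerBound P Q n
  EffDist⇒OrderLowerBound s _ _ (_ , _ , hs′ , bound) hs t d m ht =
    subst (_≤ m) (HasOrder-unique s hs′ hs) (bound t d m ht)

  agrees-below-bound : ∀ {R} → IsPreTangle G R → ∀ S y b {m n} → R y → HasOrder G y n →
    OrderLowerBound S R n → S b → HasOrder G b m → m < n → ¬ _≐_ G b (swap G b) → R b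
  agrees-below-bound ptR S y b Ry hy bound Sb hb m<n nd with orients-below ptR y b Ry hy hb m<n
  ... | inj₁ Rb = Rb
  ... | inj₂ Rb̄ = ⊥-elim (≤⇒≯ (bound b (inj₁ (Sb , Rb̄) , nd) _ hb) m<n)

  module Flanked {M Q O M′ : SepSet G}
    (ptM : IsPreTangle G M) (ptQ : IsPreTangle G Q)
    (ptO : IsPreTangle G O) (ptM′ : IsPreTangle G M′)
    (x : OSep G) {n : ℕ} (hx : HasOrder G x n)
    (Mx̄ : M (swap G x)) (Qx : Q x) (Ox̄ : O (swap G x)) (M′x : M′ x)
    (boundMQ : OrderLowerBound M Q n) (boundOM′ : OrderLowerBound O M′ n) where

    oriented-cheaper-⊥ : ∀ a {m} → HasOrder G a m → m < n → ¬ _≐_ G a (swap G a) →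
      NestedPair G a x → M (swap G a) → M′ a → ⊥
    oriented-cheaper-⊥ a {m} ha m<n nd nested Mā M′a = by-cases (NestedPair⇒≤ₛ a x nested)
      where
      x̄ = swap G x
      ā = swap G a
      hx̄ = HasOrder-swap x hx
      hā = HasOrder-swap a ha
      apart : ∀ s t → HasOrder G s n → HasOrder G t m → ¬ SameSep G s t
      apart s t hs ht = ≢order⇒¬SameSep s t hs ht (≢-sym (<⇒≢ m<n))
      Qā : Q ā
      Qā = agrees-below-bound ptQ M x ā Qx hx boundMQ Mā hā m<n (λ (eA , eB) → nd (eB , eA))
      Oa : O a
      Oa = agrees-below-bound ptO M′ x̄ a Ox̄ hx̄ (OrderLowerBound-sym O M′ boundOM′) M′a ha m<n nd
      by-cases : _≤ₛ_ G a x ⊎ _≤ₛ_ G x a ⊎ _≤ₛ_ G ā x ⊎ _≤ₛ_ G x ā → ⊥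
      by-cases (inj₁ a≤x) = consistent ptQ x ā Qx Qā (apart x ā hx hā) (≤ₛ-swap a x a≤x)
      by-cases (inj₂ (inj₁ x≤a)) = consistent ptO x̄ a Ox̄ Oa (apart x̄ a hx̄ ha) x≤a
      by-cases (inj₂ (inj₂ (inj₁ ā≤x))) =
        consistent ptM′ a x M′a M′x (≢order⇒¬SameSep a x ha hx (<⇒≢ m<n)) ā≤x
      by-cases (inj₂ (inj₂ (inj₂ x≤ā))) = consistent ptM x̄ ā Mx̄ Mā (apart x̄ ā hx̄ hā) x≤ā

    cheaper-distinguisher-⊥ : ∀ r {m} → HasOrder G r m → m < n → NestedPair G r x →
      Distinguishes G r M M′ → ⊥
    cheaper-distinguisher-⊥ r hr m<n nested (inj₂ (Mr̄ , M′r) , nd) =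
      oriented-cheaper-⊥ r hr m<n nd nested Mr̄ M′r
    cheaper-distinguisher-⊥ r hr m<n nested (inj₁ (Mr , M′r̄) , nd) =
      oriented-cheaper-⊥ (swap G r) (HasOrder-swap r hr) m<n (λ (eA , eB) → nd (eB , eA))
        (NestedPair-swapˡ r x nested) (swap-swap-∈ ptM r Mr) M′r̄

  EffDist-bridge : ∀ {𝒫 N} → AllPreTangles G 𝒫 → Nested G N → EffDistinguishesSet G N 𝒫 →
    ∀ x M Q O M′ → InN G N x → 𝒫 M → 𝒫 Q → 𝒫 O → 𝒫 M′ →
    EffDist G x M Q → M (swap G x) → EffDist G x O M′ → M′ x → EffDist G x M M′
  EffDist-bridge {N = N} all nested effN x M Q O M′ x∈N 𝒫M 𝒫Q 𝒫O 𝒫M′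
    effMQ@(dMQ@(_ , nd) , n , hx , _) Mx̄ effOM′@(dOM′ , _) M′x =
    (inj₂ (Mx̄ , M′x) , nd) , n , hx , minimal
    where
    open Flanked (all M 𝒫M) (all Q 𝒫Q) (all O 𝒫O) (all M′ 𝒫M′) x hx Mx̄
      (Distinguishes⇒∈ʳ (all M 𝒫M) x Q Mx̄ dMQ) (Distinguishes⇒∈ˡ (all M′ 𝒫M′) x O M′x dOM′) M′x
      (EffDist⇒OrderLowerBound x M Q effMQ hx) (EffDist⇒OrderLowerBound x O M′ effOM′ hx)
    minimal : OrderLowerBound M M′ n
    minimal t d m ht = ≮⇒≥ (refute (effN M M′ 𝒫M 𝒫M′ (t , d)))
      where
      refute : Σ (OSep G) (λ r → N r × EffDist G r M M′) → ¬ m < n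
      refute (r , Nr , dr , _ , hr , bound) m<n =
        cheaper-distinguisher-⊥ r hr (≤-<-trans (bound t d m ht) m<n)
          (Nested⇒NestedPair-InN nested r x Nr x∈N) dr

lemma4p4 : (G : Graph) (𝒫 : PreTangleSet G) (N : SepSet G) (f : ℕ → OSep G) →
    AllPreTangles G 𝒫 → Nested G N → EffDistinguishesSet G N 𝒫 →
    (∀ i → InN G N (f i)) → StrictlyIncreasing G f →
    StronglyRelevantSeq G 𝒫 f →
    Σ (ℕ → SepSet G) (λ P → ∀ i →
      𝒫 (P i) × P i (swap G (f i)) × P (suc i) (f i) ×
      EffDist G (f i) (P i) (P (suc i)))
lemma4p4 G 𝒫 N f all nested effN f∈N _ relevant = P , link
  where
  P : ℕ → SepSet G
  P zero = proj₁ (proj₂ (relevant 0))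
  P (suc i) = proj₁ (proj₂ (proj₂ (relevant i)))
  link : ∀ i → 𝒫 (P i) × P i (swap G (f i)) × P (suc i) (f i) ×
    EffDist G (f i) (P i) (P (suc i))
  link zero with relevant 0
  ... | _ , O , M , _ , 𝒫O , 𝒫M , _ , effOM , Mf₀ , _ =
    𝒫O , Distinguishes⇒∈ˡ G (all M 𝒫M) (f 0) O Mf₀ (proj₁ effOM) , Mf₀ , effOM
  link (suc i) with relevant i | relevant (suc i)
  ... | _ , _ , M , Q , _ , 𝒫M , 𝒫Q , _ , _ , effMQ , Mf̄
      | _ , O′ , M′ , _ , 𝒫O′ , 𝒫M′ , _ , effOM′ , M′f , _ =
    𝒫M , Mf̄ , M′f ,
    EffDist-bridge G all nested effN (f (suc i)) M Q O′ M′ (f∈N (suc i)) 𝒫M 𝒫Q 𝒫O′ 𝒫M′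
      effMQ Mf̄ effOM′ M′f
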